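{- Let $n,k,\ell,\alpha,\beta,\gamma$ be non-negative integers. Then $$S^{\gamma,\alpha,\beta}_{n,k,\ell}=\sum_{i=0}^{n}\sum_{j=0}^{k}\binom{n}{i}\left\{ {i \atop j} \right\}^{>\ell}_{\gamma}\left\{ {n-i \atop k-j} \right\}^{\le\ell}_{\alpha,\beta}.$$
   Context: Degenerate falling factorial: $(t)_{m,\lambda}=t(t-\lambda)\cdots(t-(m-1)\lambda)$, $(t)_{0,\lambda}=1$. All the following numbers are defined as weighted sums over pairs $(G,P)$ where $G$ is a possibly empty subset of the ground set $\{1,\dots,m\}$ and $P$ is a set partition of the complement of $G$ into a prescribed number of non-empty blocks; $0^0=1$. (1) $\left\{ {m \atop j} \right\}^{>\ell}_{\gamma}$: $P$ has $j$ blocks, each with more than $\ell$ elements; weight $\gamma^{|G|}$. (2) $\left\{ {m \atop j} \right\}^{\le\ell}_{\alpha,\beta}$: $G=\emptyset$, $P$ has $j$ blocks each with at most $\ell$ elements; weight $\prod_{B\in P}(\beta-\alpha)_{|B|-1,\alpha}$. (3) $S^{\gamma,\alpha,\beta}_{m,k,\ell}$ (number of $\ell$-restricted $(\alpha,\beta,\gamma)$-partial degenerate partitions): $P$ has $k$ blocks of arbitrary sizes; weight $\gamma^{|G|}\prod_{B\in P}w(B)$ where $w(B)=(\beta-\alpha)_{|B|-1,\alpha}$ if $|B|\le\ell$ and $w(B)=1$ if $|B|>\ell$. (Combinatorially: $G$ is a free cell with $\gamma$ compartments, blocks of size $>\ell$ are free cells of order $1$, blocks of size $\le\ell$ are cells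 of order $\beta$ with the $\alpha$-closing property and a favorite compartment.) -}

module Defs where

open import Data.Nat as ℕ using (ℕ; zero; suc; _∸_; _≡ᵇ_; _<ᵇ_)
open import Data.Nat.Combinatorics using (_C_)
open import Data.Integer as ℤ using (ℤ; +_; _-_; _*_; _+_)
open import Data.List using (List; []; _∷_; map; concatMap; length; foldr; upTo)
open import Data.Bool using (Bool; true; false; if_then_else_; _∧_; not)
open import Data.Product using (_×_; _,_)

fallDeg : ℤ → ℕ → ℤ → ℤ
fallDeg t zero    l = + 1
fallDeg t (suc m) l = fallDeg t m l * (t - (+ m) * l)

-- A block is a list of elements of the ground set; a configuration is a pair (G , P)
-- with G ⊆ {1..m} and P a set partition of the complement of G into non-empty blocks.
Block : Set
Block = List ℕ

Config : Set
Config = List ℕ × List Block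

insertEach : ℕ → List Block → List (List Block)
insertEach x []      = []
insertEach x (B ∷ P) = ((x ∷ B) ∷ P) ∷ map (B ∷_) (insertEach x P)

-- Enumeration (each exactly once) of all pairs (G , P) over the ground set {1, ..., m}:
-- the element m+1 either goes to G, forms a new singleton block, or joins an existing block.
configs : ℕ → List Config
configs zero    = ([] , []) ∷ []
configs (suc m) = concatMap step (configs m)
  where
  step : Config → List Config
  step (G , P) = (suc m ∷ G , P) ∷ (G , (suc m ∷ []) ∷ P) ∷ map (λ P' → G , P') (insertEach (suc m) P)

allB : {A : Set} → (A → Bool) → List A → Bool
allB p [] = true
allB p (x ∷ xs) = p x ∧ allB p xs

sumℤ : List ℤ → ℤ
sumℤ = foldr _+_ (+ 0)

prodℤ : List ℤ → ℤ
prodℤ = foldr _*_ (+ 1)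

sumTo : ℕ → (ℕ → ℤ) → ℤ
sumTo n f = sumℤ (map f (upTo (suc n)))

indicator : Bool → ℤ → ℤ
indicator b x = if b then x else + 0

bigStirling : ℕ → ℕ → ℕ → ℤ → ℤ
bigStirling m j ℓ γ = sumℤ (map w (configs m))
  where
  w : Config → ℤ
  w (G , P) = indicator ((length P ≡ᵇ j) ∧ allB (λ B → ℓ <ᵇ length B) P) (γ ℤ.^ length G)

blockW : ℤ → ℤ → Block → ℤ
blockW α β B = fallDeg (β - α) (length B ∸ 1) α

isEmpty : List ℕ → Bool
isEmpty [] = true
isEmpty (_ ∷ _) = false

smallStirling : ℕ → ℕ → ℕ → ℤ → ℤ → ℤ
smallStirling m j ℓ α β = sumℤ (map w (configs m))
  where
  w : Config → ℤ
  w (G , P) = indicator (isEmpty G ∧ (length P ≡ᵇ j) ∧ allB (λ B → not (ℓ <ᵇ length B)) P)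
                        (prodℤ (map (blockW α β) P))

restrictedS : ℕ → ℕ → ℕ → ℤ → ℤ → ℤ → ℤ
restrictedS m k ℓ γ α β = sumℤ (map w (configs m))
  where
  wB : Block → ℤ
  wB B = if ℓ <ᵇ length B then + 1 else blockW α β B
  w : Config → ℤ
  w (G , P) = indicator (length P ≡ᵇ k) (γ ℤ.^ length G * prodℤ (map wB P))

-- All weights involved depend on a configuration (G , P) only through |G| and the list of block
-- sizes, so a sum over the configurations of {1..n+1} is the sum over those of {1..n} of the
-- operator Δ (element n+1 joins G, opens a singleton, or joins a block) applied to the weight.
-- The weight of S factors as (γ + 0)^|G| · Π_B (w_large(B) + w_small(B)); expanding it colours every
-- free element and every block "large" or "small", and Δ obeys a Leibniz rule with respect to
-- this splitting. Iterating it n times distributes the n elements between the two colours, which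
-- gives the binomial sum over the number i of large elements; the prescribed total number k of
-- blocks becomes a convolution over the number j of large blocks.

module Submission where

open import Defs
open import Data.Nat using (ℕ; _∸_)
open import Data.Nat.Combinatorics using (_C_)
open import Data.Integer using (ℤ; +_; _*_)
open import Relation.Binary.PropositionalEquality using (_≡_)

open import Data.Nat as ℕ using (zero; suc; _<_; z≤n; s≤s; _≡ᵇ_; _<ᵇ_)
import Data.Nat.Properties as ℕP
open import Data.Nat.Combinatorics using (nCk+nC[k+1]≡[n+1]C[k+1]; k>n⇒nCk≡0)
open import Data.Integer as ℤ using (_+_; _-_; _^_)
import Data.Integer.Properties as ℤP
open import Data.Integer.Solver using (module +-*-Solver)
open import Data.List using (List; []; _∷_; map; concatMap; length; _++_; applyUpTo; upTo)
open import Data.List.Properties using (length-map; map-∘; map-cong)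
open import Data.Bool using (Bool; true; false; not; _∧_; if_then_else_)
open import Data.Product using (_,_)
open import Function using (_∘_)
open import Relation.Binary.PropositionalEquality using (refl; sym; trans; cong; cong₂; module ≡-Reasoning)
open import Algebra.Properties.CommutativeSemigroup ℤP.+-commutativeSemigroup using (interchange; x∙yz≈y∙xz)
import Algebra.Properties.CommutativeSemigroup ℤP.*-commutativeSemigroup as *-Semigroup

open +-*-Solver
open ≡-Reasoning

∑ : {A : Set} → (A → ℤ) → List A → ℤ
∑ f xs = sumℤ (map f xs)

module _ {A : Set} where

  ∑-cong : {f g : A → ℤ} → (∀ x → f x ≡ g x) → ∀ xs → ∑ f xs ≡ ∑ g xs
  ∑-cong f≡g []       = refl
  ∑-cong f≡g (x ∷ xs) = cong₂ _+_ (f≡g x) (∑-cong f≡g xs)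

  ∑-zero : ∀ xs → ∑ {A} (λ _ → + 0) xs ≡ + 0
  ∑-zero []       = refl
  ∑-zero (x ∷ xs) = trans (ℤP.+-identityˡ _) (∑-zero xs)

  ∑-+ : (f g : A → ℤ) → ∀ xs → ∑ (λ x → f x + g x) xs ≡ ∑ f xs + ∑ g xs
  ∑-+ f g []       = refl
  ∑-+ f g (x ∷ xs) = trans (cong (_+_ (f x + g x)) (∑-+ f g xs)) (interchange (f x) (g x) _ _)

  ∑-++ : (f : A → ℤ) → ∀ xs ys → ∑ f (xs ++ ys) ≡ ∑ f xs + ∑ f ys
  ∑-++ f []       ys = sym (ℤP.+-identityˡ _)
  ∑-++ f (x ∷ xs) ys = trans (cong (_+_ (f x)) (∑-++ f xs ys)) (sym (ℤP.+-assoc (f x) _ _))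

  ∑-*ˡ : ∀ c (f : A → ℤ) xs → c * ∑ f xs ≡ ∑ (λ x → c * f x) xs
  ∑-*ˡ c f []       = ℤP.*-zeroʳ c
  ∑-*ˡ c f (x ∷ xs) = trans (ℤP.*-distribˡ-+ c (f x) _) (cong (_+_ (c * f x)) (∑-*ˡ c f xs))

  ∑-*ʳ : ∀ c (f : A → ℤ) xs → ∑ f xs * c ≡ ∑ (λ x → f x * c) xs
  ∑-*ʳ c f xs = trans (ℤP.*-comm _ c) (trans (∑-*ˡ c f xs) (∑-cong (λ x → ℤP.*-comm c (f x)) xs))

module _ {A B : Set} where

  ∑-map : (f : B → ℤ) (g : A → B) → ∀ xs → ∑ f (map g xs) ≡ ∑ (f ∘ g) xs
  ∑-map f g []       = refl
  ∑-map f g (x ∷ xs) = cong (_+_ (f (g x))) (∑-map f g xs)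

  ∑-concatMap : (f : B → ℤ) (g : A → List B) → ∀ xs →
                ∑ f (concatMap g xs) ≡ ∑ (λ x → ∑ f (g x)) xs
  ∑-concatMap f g []       = refl
  ∑-concatMap f g (x ∷ xs) =
    trans (∑-++ f (g x) _) (cong (_+_ (∑ f (g x))) (∑-concatMap f g xs))

  ∑-comm : (h : A → B → ℤ) → ∀ xs ys →
           ∑ (λ y → ∑ (λ x → h x y) xs) ys ≡ ∑ (λ x → ∑ (h x) ys) xs
  ∑-comm h xs []       = sym (∑-zero xs)
  ∑-comm h xs (y ∷ ys) =
    trans (cong (_+_ (∑ (λ x → h x y) xs)) (∑-comm h xs ys)) (sym (∑-+ (λ x → h x y) _ xs))

  ∑-*-∑ : (f : A → ℤ) (g : B → ℤ) → ∀ xs ys → ∑ f xs * ∑ g ys ≡ ∑ (λ x → ∑ (λ y → f x * g y) ys) xs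
  ∑-*-∑ f g xs ys = trans (∑-*ʳ (∑ g ys) f xs) (∑-cong (λ x → ∑-*ˡ (f x) g ys) xs)

∑< : ℕ → (ℕ → ℤ) → ℤ
∑< zero    f = + 0
∑< (suc n) f = f 0 + ∑< n (f ∘ suc)

∑-applyUpTo : (f : ℕ → ℤ) (h : ℕ → ℕ) → ∀ n → ∑ f (applyUpTo h n) ≡ ∑< n (f ∘ h)
∑-applyUpTo f h zero    = refl
∑-applyUpTo f h (suc n) = cong (_+_ (f (h 0))) (∑-applyUpTo f (h ∘ suc) n)

sumTo≡∑< : ∀ n f → sumTo n f ≡ ∑< (suc n) f
sumTo≡∑< n f = ∑-applyUpTo f (λ i → i) (suc n)

∑<-cong : ∀ n {f g : ℕ → ℤ} → (∀ i → i < n → f i ≡ g i) → ∑< n f ≡ ∑< n g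
∑<-cong zero    f≡g = refl
∑<-cong (suc n) f≡g = cong₂ _+_ (f≡g 0 (s≤s z≤n)) (∑<-cong n (λ i i<n → f≡g (suc i) (s≤s i<n)))

∑<-zero : ∀ n → ∑< n (λ _ → + 0) ≡ + 0
∑<-zero zero    = refl
∑<-zero (suc n) = trans (ℤP.+-identityˡ _) (∑<-zero n)

∑<-+ : ∀ n (f g : ℕ → ℤ) → ∑< n (λ i → f i + g i) ≡ ∑< n f + ∑< n g
∑<-+ zero    f g = refl
∑<-+ (suc n) f g = trans (cong (_+_ (f 0 + g 0)) (∑<-+ n (f ∘ suc) (g ∘ suc))) (interchange (f 0) (g 0) _ _)

∑<-snoc : ∀ n (f : ℕ → ℤ) → ∑< (suc n) f ≡ ∑< n f + f n
∑<-snoc zero    f = trans (ℤP.+-identityʳ (f 0)) (sym (ℤP.+-identityˡ (f 0)))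
∑<-snoc (suc n) f = trans (cong (_+_ (f 0)) (∑<-snoc n (f ∘ suc))) (sym (ℤP.+-assoc (f 0) _ _))

Weight : Set
Weight = ℕ → List ℕ → ℤ

sizes : List Block → List ℕ
sizes = map length

profile : Weight → Config → ℤ
profile f (G , P) = f (length G) (sizes P)

∑configs : ℕ → Weight → ℤ
∑configs n f = ∑ (profile f) (configs n)

incrementEach : List ℕ → List (List ℕ)
incrementEach []       = []
incrementEach (s ∷ ss) = (suc s ∷ ss) ∷ map (s ∷_) (incrementEach ss)

newFree : Weight → Weight
newFree f g ss = f (suc g) ss

addBlock : ℕ → Weight → Weight
addBlock s f g ss = f g (s ∷ ss)

joinBlock : Weight → Weight
joinBlock f g ss = ∑ (f g) (incrementEach ss)

Δ : Weight → Weight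
Δ f g ss = newFree f g ss + (addBlock 1 f g ss + joinBlock f g ss)

∑-insertEach : (h : List ℕ → ℤ) → ∀ x P → ∑ (h ∘ sizes) (insertEach x P) ≡ ∑ h (incrementEach (sizes P))
∑-insertEach h x []      = refl
∑-insertEach h x (B ∷ P) = cong (_+_ (h (suc (length B) ∷ sizes P))) (begin
  ∑ (h ∘ sizes) (map (B ∷_) (insertEach x P))          ≡⟨ ∑-map (h ∘ sizes) (B ∷_) (insertEach x P) ⟩
  ∑ (h ∘ (length B ∷_) ∘ sizes) (insertEach x P)       ≡⟨ ∑-insertEach (h ∘ (length B ∷_)) x P ⟩
  ∑ (h ∘ (length B ∷_)) (incrementEach (sizes P))     ≡⟨ ∑-map h (length B ∷_) (incrementEach (sizes P)) ⟨
  ∑ h (map (length B ∷_) (incrementEach (sizes P)))   ∎)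

∑configs-suc : ∀ n f → ∑configs (suc n) f ≡ ∑configs n (Δ f)
∑configs-suc n f =
  trans (∑-concatMap (profile f) _ (configs n)) (∑-cong (λ (G , P) → extend G P) (configs n))
  where
  extend : ∀ G P → ∑ (profile f) ((suc n ∷ G , P) ∷ (G , (suc n ∷ []) ∷ P) ∷ map (G ,_) (insertEach (suc n) P))
                   ≡ Δ f (length G) (sizes P)
  extend G P = cong (λ z → f (suc (length G)) (sizes P) + (f (length G) (1 ∷ sizes P) + z)) (begin
    ∑ (profile f) (map (G ,_) (insertEach (suc n) P))  ≡⟨ ∑-map (profile f) (G ,_) (insertEach (suc n) P) ⟩
    ∑ (f (length G) ∘ sizes) (insertEach (suc n) P)   ≡⟨ ∑-insertEach (f (length G)) (suc n) P ⟩
    joinBlock f (length G) (sizes P)                  ∎)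

Δ-∑ : {A : Set} (h : ℕ → List ℕ → A → ℤ) (xs : List A) → ∀ g ss →
      Δ (λ g′ ss′ → ∑ (h g′ ss′) xs) g ss ≡ ∑ (λ x → Δ (λ g′ ss′ → h g′ ss′ x) g ss) xs
Δ-∑ h xs g ss = begin
  ∑ (h (suc g) ss) xs + (∑ (h g (1 ∷ ss)) xs + ∑ (λ y → ∑ (h g y) xs) (incrementEach ss))
    ≡⟨ cong (λ z → ∑ (h (suc g) ss) xs + (∑ (h g (1 ∷ ss)) xs + z)) (∑-comm (λ x y → h g y x) xs (incrementEach ss)) ⟩
  ∑ (h (suc g) ss) xs + (∑ (h g (1 ∷ ss)) xs + ∑ (λ x → ∑ (λ y → h g y x) (incrementEach ss)) xs)
    ≡⟨ cong (_+_ (∑ (h (suc g) ss) xs)) (∑-+ (h g (1 ∷ ss)) _ xs) ⟨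
  ∑ (h (suc g) ss) xs + ∑ (λ x → h g (1 ∷ ss) x + ∑ (λ y → h g y x) (incrementEach ss)) xs
    ≡⟨ ∑-+ (h (suc g) ss) _ xs ⟨
  ∑ (λ x → Δ (λ g′ ss′ → h g′ ss′ x) g ss) xs ∎

Weight₂ : Set
Weight₂ = ℕ → List ℕ → ℕ → List ℕ → ℤ

onLeft onRight : (Weight → Weight) → Weight₂ → Weight₂
onLeft  D H g₁ s₁ g₂ s₂ = D (λ g s → H g s g₂ s₂) g₁ s₁
onRight D H g₁ s₁ g₂ s₂ = D (H g₁ s₁) g₂ s₂

infixl 6 _⊕_
_⊕_ : Weight₂ → Weight₂ → Weight₂
(H ⊕ K) g₁ s₁ g₂ s₂ = H g₁ s₁ g₂ s₂ + K g₁ s₁ g₂ s₂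

split : Weight₂ → Weight
split H (suc g) ss       = split (onLeft newFree H) g ss + split (onRight newFree H) g ss
split H zero    (s ∷ ss) = split (onLeft (addBlock s) H) zero ss + split (onRight (addBlock s) H) zero ss
split H zero    []       = H 0 [] 0 []

split-cong : {H K : Weight₂} → (∀ g₁ s₁ g₂ s₂ → H g₁ s₁ g₂ s₂ ≡ K g₁ s₁ g₂ s₂) →
             ∀ g ss → split H g ss ≡ split K g ss
split-cong H≡K (suc g) ss =
  cong₂ _+_ (split-cong (λ g₁ → H≡K (suc g₁)) g ss) (split-cong (λ g₁ s₁ g₂ → H≡K g₁ s₁ (suc g₂)) g ss)
split-cong H≡K zero (s ∷ ss) =
  cong₂ _+_ (split-cong (λ g₁ s₁ → H≡K g₁ (s ∷ s₁)) zero ss)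
            (split-cong (λ g₁ s₁ g₂ s₂ → H≡K g₁ s₁ g₂ (s ∷ s₂)) zero ss)
split-cong H≡K zero    []       = H≡K 0 [] 0 []

split-⊕ : ∀ H K g ss → split (H ⊕ K) g ss ≡ split H g ss + split K g ss
split-⊕ H K (suc g) ss =
  trans (cong₂ _+_ (split-⊕ (L H) (L K) g ss) (split-⊕ (R H) (R K) g ss))
        (interchange (split (L H) g ss) (split (L K) g ss) (split (R H) g ss) (split (R K) g ss))
  where
  L R : Weight₂ → Weight₂
  L = onLeft newFree
  R = onRight newFree
split-⊕ H K zero (s ∷ ss) =
  trans (cong₂ _+_ (split-⊕ (L H) (L K) zero ss) (split-⊕ (R H) (R K) zero ss))
        (interchange (split (L H) zero ss) (split (L K) zero ss) (split (R H) zero ss) (split (R K) zero ss))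
  where
  L R : Weight₂ → Weight₂
  L = onLeft (addBlock s)
  R = onRight (addBlock s)
split-⊕ H K zero [] = refl

split-*ˡ : ∀ c H g ss → split (λ g₁ s₁ g₂ s₂ → c * H g₁ s₁ g₂ s₂) g ss ≡ c * split H g ss
split-*ˡ c H (suc g) ss =
  trans (cong₂ _+_ (split-*ˡ c (onLeft newFree H) g ss) (split-*ˡ c (onRight newFree H) g ss))
        (sym (ℤP.*-distribˡ-+ c _ _))
split-*ˡ c H zero (s ∷ ss) =
  trans (cong₂ _+_ (split-*ˡ c (onLeft (addBlock s) H) zero ss) (split-*ˡ c (onRight (addBlock s) H) zero ss))
        (sym (ℤP.*-distribˡ-+ c _ _))
split-*ˡ c H zero [] = refl

split-∷ : ∀ H s g ss → split H g (s ∷ ss) ≡ split (onLeft (addBlock s) H) g ss + split (onRight (addBlock s) H) g ss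
split-∷ H s zero    ss = refl
split-∷ H s (suc g) ss =
  trans (cong₂ _+_ (split-∷ (L H) s g ss) (split-∷ (R H) s g ss))
        (interchange (split (L′ (L H)) g ss) (split (R′ (L H)) g ss) (split (L′ (R H)) g ss) (split (R′ (R H)) g ss))
  where
  L R L′ R′ : Weight₂ → Weight₂
  L  = onLeft newFree
  R  = onRight newFree
  L′ = onLeft (addBlock s)
  R′ = onRight (addBlock s)

joinBlock-∷ : ∀ f s g ss → joinBlock f g (s ∷ ss) ≡ addBlock (suc s) f g ss + joinBlock (addBlock s f) g ss
joinBlock-∷ f s g ss = cong (_+_ (f g (suc s ∷ ss))) (∑-map (f g) (s ∷_) (incrementEach ss))

joinBlock₂ : Weight₂ → Weight₂
joinBlock₂ H = onLeft joinBlock H ⊕ onRight joinBlock H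

split-joinBlock : ∀ H g ss → joinBlock (split H) g ss ≡ split (joinBlock₂ H) g ss
split-joinBlock H (suc g) ss =
  trans (∑-+ (split (onLeft newFree H) g) (split (onRight newFree H) g) (incrementEach ss))
        (cong₂ _+_ (split-joinBlock (onLeft newFree H) g ss) (split-joinBlock (onRight newFree H) g ss))
split-joinBlock H zero [] = refl
split-joinBlock H zero (s ∷ ss) = begin
  joinBlock (split H) zero (s ∷ ss)
    ≡⟨ joinBlock-∷ (split H) s zero ss ⟩
  split H zero (suc s ∷ ss) + joinBlock (addBlock s (split H)) zero ss
    ≡⟨ cong (_+_ (split H zero (suc s ∷ ss))) (∑-+ (split (L H) zero) (split (R H) zero) (incrementEach ss)) ⟩
  (split (L′ H) zero ss + split (R′ H) zero ss) + (joinBlock (split (L H)) zero ss + joinBlock (split (R H)) zero ss)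
    ≡⟨ cong₂ (λ x y → (split (L′ H) zero ss + split (R′ H) zero ss) + (x + y))
             (split-joinBlock (L H) zero ss) (split-joinBlock (R H) zero ss) ⟩
  (split (L′ H) zero ss + split (R′ H) zero ss) + (split (joinBlock₂ (L H)) zero ss + split (joinBlock₂ (R H)) zero ss)
    ≡⟨ interchange (split (L′ H) zero ss) _ (split (joinBlock₂ (L H)) zero ss) _ ⟩
  (split (L′ H) zero ss + split (joinBlock₂ (L H)) zero ss) + (split (R′ H) zero ss + split (joinBlock₂ (R H)) zero ss)
    ≡⟨ cong₂ _+_ (split-⊕ (L′ H) (joinBlock₂ (L H)) zero ss) (split-⊕ (R′ H) (joinBlock₂ (R H)) zero ss) ⟨
  split (L′ H ⊕ joinBlock₂ (L H)) zero ss + split (R′ H ⊕ joinBlock₂ (R H)) zero ss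
    ≡⟨ cong₂ _+_ (split-cong joinˡ zero ss) (split-cong joinʳ zero ss) ⟨
  split (joinBlock₂ H) zero (s ∷ ss) ∎
  where
  L R L′ R′ : Weight₂ → Weight₂
  L  = onLeft (addBlock s)
  R  = onRight (addBlock s)
  L′ = onLeft (addBlock (suc s))
  R′ = onRight (addBlock (suc s))
  joinˡ : ∀ g₁ s₁ g₂ s₂ → L (joinBlock₂ H) g₁ s₁ g₂ s₂ ≡ (L′ H ⊕ joinBlock₂ (L H)) g₁ s₁ g₂ s₂
  joinˡ g₁ s₁ g₂ s₂ =
    trans (cong (_+ onRight joinBlock H g₁ (s ∷ s₁) g₂ s₂) (joinBlock-∷ (λ g s → H g s g₂ s₂) s g₁ s₁))
          (ℤP.+-assoc (H g₁ (suc s ∷ s₁) g₂ s₂) (joinBlock (addBlock s (λ g s → H g s g₂ s₂)) g₁ s₁) _)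
  joinʳ : ∀ g₁ s₁ g₂ s₂ → R (joinBlock₂ H) g₁ s₁ g₂ s₂ ≡ (R′ H ⊕ joinBlock₂ (R H)) g₁ s₁ g₂ s₂
  joinʳ g₁ s₁ g₂ s₂ =
    trans (cong (_+_ (onLeft joinBlock H g₁ s₁ g₂ (s ∷ s₂))) (joinBlock-∷ (H g₁ s₁) s g₂ s₂))
          (x∙yz≈y∙xz (onLeft joinBlock H g₁ s₁ g₂ (s ∷ s₂)) (H g₁ s₁ g₂ (suc s ∷ s₂)) _)

split-Δ : ∀ H g ss → Δ (split H) g ss ≡ split (onLeft Δ H ⊕ onRight Δ H) g ss
split-Δ H g ss = begin
  split H (suc g) ss + (split H g (1 ∷ ss) + joinBlock (split H) g ss)
    ≡⟨ cong₂ (λ x y → split H (suc g) ss + (x + y)) (split-∷ H 1 g ss)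
             (trans (split-joinBlock H g ss) (split-⊕ (onLeft joinBlock H) (onRight joinBlock H) g ss)) ⟩
  (a + b) + ((c + d) + (e + f))
    ≡⟨ cong (_+_ (a + b)) (interchange c d e f) ⟩
  (a + b) + ((c + e) + (d + f))
    ≡⟨ interchange a b (c + e) (d + f) ⟩
  (a + (c + e)) + (b + (d + f))
    ≡⟨ cong₂ _+_ (cong (_+_ a) (split-⊕ (L₁ H) (Lⱼ H) g ss)) (cong (_+_ b) (split-⊕ (R₁ H) (Rⱼ H) g ss)) ⟨
  split (onLeft newFree H) g ss + split (L₁ H ⊕ Lⱼ H) g ss + (split (onRight newFree H) g ss + split (R₁ H ⊕ Rⱼ H) g ss)
    ≡⟨ cong₂ _+_ (split-⊕ (onLeft newFree H) (L₁ H ⊕ Lⱼ H) g ss) (split-⊕ (onRight newFree H) (R₁ H ⊕ Rⱼ H) g ss) ⟨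
  split (onLeft newFree H ⊕ (L₁ H ⊕ Lⱼ H)) g ss + split (onRight newFree H ⊕ (R₁ H ⊕ Rⱼ H)) g ss
    ≡⟨ split-⊕ (onLeft Δ H) (onRight Δ H) g ss ⟨
  split (onLeft Δ H ⊕ onRight Δ H) g ss ∎
  where
  L₁ R₁ Lⱼ Rⱼ : Weight₂ → Weight₂
  L₁ = onLeft (addBlock 1)
  R₁ = onRight (addBlock 1)
  Lⱼ = onLeft joinBlock
  Rⱼ = onRight joinBlock
  a b c d e f : ℤ
  a = split (onLeft newFree H) g ss
  b = split (onRight newFree H) g ss
  c = split (L₁ H) g ss
  d = split (R₁ H) g ss
  e = split (Lⱼ H) g ss
  f = split (Rⱼ H) g ss

latticeSum : ℕ → (ℕ → ℕ → ℤ) → ℤ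
latticeSum zero    F = F 0 0
latticeSum (suc n) F = latticeSum n (λ i j → F (suc i) j) + latticeSum n (λ i j → F i (suc j))

latticeSum-cong : ∀ n {F F′ : ℕ → ℕ → ℤ} → (∀ i j → F i j ≡ F′ i j) → latticeSum n F ≡ latticeSum n F′
latticeSum-cong zero    F≡F′ = F≡F′ 0 0
latticeSum-cong (suc n) F≡F′ =
  cong₂ _+_ (latticeSum-cong n (λ i → F≡F′ (suc i))) (latticeSum-cong n (λ i j → F≡F′ i (suc j)))

latticeSum-+ : ∀ n (F F′ : ℕ → ℕ → ℤ) →
               latticeSum n (λ i j → F i j + F′ i j) ≡ latticeSum n F + latticeSum n F′
latticeSum-+ zero    F F′ = refl
latticeSum-+ (suc n) F F′ =
  trans (cong₂ _+_ (latticeSum-+ n (λ i → F (suc i)) (λ i → F′ (suc i)))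
                   (latticeSum-+ n (λ i j → F i (suc j)) (λ i j → F′ i (suc j))))
        (interchange (latticeSum n (λ i → F (suc i))) (latticeSum n (λ i → F′ (suc i))) _ _)

latticeSum≡binomialSum : ∀ n F → latticeSum n F ≡ ∑< (suc n) (λ i → + (n C i) * F i (n ∸ i))
latticeSum≡binomialSum zero    F = sym (trans (ℤP.+-identityʳ _) (ℤP.*-identityˡ (F 0 0)))
latticeSum≡binomialSum (suc n) F = begin
  latticeSum n (λ i → F (suc i)) + latticeSum n (λ i j → F i (suc j))
    ≡⟨ cong₂ _+_ (latticeSum≡binomialSum n (λ i → F (suc i))) (latticeSum≡binomialSum n (λ i j → F i (suc j))) ⟩
  ∑< (suc n) up + (b₀ + ∑< n (λ i → + (n C suc i) * F (suc i) (suc (n ∸ suc i))))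
    ≡⟨ cong (λ z → ∑< (suc n) up + (b₀ + z))
            (∑<-cong n (λ i i<n → cong (λ m → + (n C suc i) * F (suc i) m) (sym (ℕP.+-∸-assoc 1 i<n)))) ⟩
  ∑< (suc n) up + (b₀ + ∑< n right)
    ≡⟨ x∙yz≈y∙xz (∑< (suc n) up) b₀ (∑< n right) ⟩
  b₀ + (∑< (suc n) up + ∑< n right)
    ≡⟨ cong (_+_ b₀) pascal ⟨
  ∑< (suc (suc n)) (λ i → + (suc n C i) * F i (suc n ∸ i)) ∎
  where
  b₀ : ℤ
  b₀ = + 1 * F 0 (suc n)
  up right : ℕ → ℤ
  up    i = + (n C i) * F (suc i) (n ∸ i)
  right i = + (n C suc i) * F (suc i) (n ∸ i)
  pascal : ∑< (suc n) (λ i → + (suc n C suc i) * F (suc i) (n ∸ i)) ≡ ∑< (suc n) up + ∑< n right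
  pascal = begin
    ∑< (suc n) (λ i → + (suc n C suc i) * F (suc i) (n ∸ i))
      ≡⟨ ∑<-cong (suc n) (λ i _ → trans (cong (λ m → + m * F (suc i) (n ∸ i)) (sym (nCk+nC[k+1]≡[n+1]C[k+1] n i)))
                                        (ℤP.*-distribʳ-+ (F (suc i) (n ∸ i)) (+ (n C i)) (+ (n C suc i)))) ⟩
    ∑< (suc n) (λ i → up i + right i)
      ≡⟨ trans (∑<-+ (suc n) up right) (cong (_+_ (∑< (suc n) up)) (∑<-snoc n right)) ⟩
    ∑< (suc n) up + (∑< n right + right n)
      ≡⟨ cong (λ m → ∑< (suc n) up + (∑< n right + + m * F (suc n) (n ∸ n))) (k>n⇒nCk≡0 (ℕP.n<1+n n)) ⟩
    ∑< (suc n) up + (∑< n right + + 0)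
      ≡⟨ cong (_+_ (∑< (suc n) up)) (ℤP.+-identityʳ _) ⟩
    ∑< (suc n) up + ∑< n right ∎

∑configs² : ℕ → ℕ → Weight₂ → ℤ
∑configs² i j H = ∑configs i (λ g₁ s₁ → ∑configs j (H g₁ s₁))

∑configs²-Δ : ∀ H i j → ∑configs² i j (onLeft Δ H ⊕ onRight Δ H) ≡ ∑configs² (suc i) j H + ∑configs² i (suc j) H
∑configs²-Δ H i j = begin
  ∑configs² i j (onLeft Δ H ⊕ onRight Δ H)
    ≡⟨ ∑-cong (λ (G , P) → ∑-+ (profile (onLeft Δ H (length G) (sizes P))) _ (configs j)) (configs i) ⟩
  ∑ (λ (G , P) → ∑configs j (onLeft Δ H (length G) (sizes P)) + ∑configs j (onRight Δ H (length G) (sizes P))) (configs i)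
    ≡⟨ ∑-+ (λ (G , P) → ∑configs j (onLeft Δ H (length G) (sizes P))) _ (configs i) ⟩
  ∑configs i (λ g s → ∑configs j (onLeft Δ H g s)) + ∑configs i (λ g s → ∑configs j (onRight Δ H g s))
    ≡⟨ cong₂ _+_ (∑-cong (λ (G , P) → Δ-∑ (λ g s → profile (H g s)) (configs j) (length G) (sizes P)) (configs i))
                 (∑-cong (λ (G , P) → ∑configs-suc j (H (length G) (sizes P))) (configs i)) ⟨
  ∑configs i (Δ F) + ∑configs² i (suc j) H
    ≡⟨ cong (_+ ∑configs² i (suc j) H) (∑configs-suc i F) ⟨
  ∑configs² (suc i) j H + ∑configs² i (suc j) H ∎
  where
  F : Weight
  F g s = ∑configs j (H g s)

∑configs-split : ∀ n H → ∑configs n (split H) ≡ latticeSum n (λ i j → ∑configs² i j H)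
∑configs-split zero    H = sym (ℤP.+-identityʳ _)
∑configs-split (suc n) H = begin
  ∑configs (suc n) (split H)
    ≡⟨ ∑configs-suc n (split H) ⟩
  ∑configs n (Δ (split H))
    ≡⟨ ∑-cong (λ (G , P) → split-Δ H (length G) (sizes P)) (configs n) ⟩
  ∑configs n (split (onLeft Δ H ⊕ onRight Δ H))
    ≡⟨ ∑configs-split n (onLeft Δ H ⊕ onRight Δ H) ⟩
  latticeSum n (λ i j → ∑configs² i j (onLeft Δ H ⊕ onRight Δ H))
    ≡⟨ latticeSum-cong n (∑configs²-Δ H) ⟩
  latticeSum n (λ i j → ∑configs² (suc i) j H + ∑configs² i (suc j) H)
    ≡⟨ latticeSum-+ n (λ i j → ∑configs² (suc i) j H) (λ i j → ∑configs² i (suc j) H) ⟩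
  latticeSum (suc n) (λ i j → ∑configs² i j H) ∎

split-blockCount : ∀ (Q : ℕ → ℤ) H g ss →
  split (λ g₁ s₁ g₂ s₂ → Q (length s₁ ℕ.+ length s₂) * H g₁ s₁ g₂ s₂) g ss ≡ Q (length ss) * split H g ss
split-blockCount Q H (suc g) ss =
  trans (cong₂ _+_ (split-blockCount Q (onLeft newFree H) g ss) (split-blockCount Q (onRight newFree H) g ss))
        (sym (ℤP.*-distribˡ-+ (Q (length ss)) _ _))
split-blockCount Q H zero [] = refl
split-blockCount Q H zero (s ∷ ss) =
  trans (cong₂ _+_ (split-blockCount (Q ∘ suc) (onLeft (addBlock s) H) zero ss)
                   (trans (split-cong (λ g₁ s₁ g₂ s₂ → cong (λ m → Q m * H g₁ s₁ g₂ (s ∷ s₂))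
                                                            (ℕP.+-suc (length s₁) (length s₂))) zero ss)
                          (split-blockCount (Q ∘ suc) (onRight (addBlock s) H) zero ss)))
        (sym (ℤP.*-distribˡ-+ (Q (suc (length ss))) _ _))

Π : (ℕ → ℤ) → List ℕ → ℤ
Π a ss = prodℤ (map a ss)

productWeight : ℤ → ℤ → (ℕ → ℤ) → (ℕ → ℤ) → Weight₂
productWeight γ₁ γ₂ a₁ a₂ g₁ s₁ g₂ s₂ = (γ₁ ^ g₁ * γ₂ ^ g₂) * (Π a₁ s₁ * Π a₂ s₂)

split-productWeight : ∀ γ₁ γ₂ a₁ a₂ g ss →
  split (productWeight γ₁ γ₂ a₁ a₂) g ss ≡ (γ₁ + γ₂) ^ g * Π (λ s → a₁ s + a₂ s) ss
split-productWeight γ₁ γ₂ a₁ a₂ (suc g) ss = begin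
  split (onLeft newFree W) g ss + split (onRight newFree W) g ss
    ≡⟨ cong₂ _+_ (trans (split-cong freeˡ g ss) (split-*ˡ γ₁ W g ss))
                 (trans (split-cong freeʳ g ss) (split-*ˡ γ₂ W g ss)) ⟩
  γ₁ * split W g ss + γ₂ * split W g ss
    ≡⟨ ℤP.*-distribʳ-+ (split W g ss) γ₁ γ₂ ⟨
  (γ₁ + γ₂) * split W g ss
    ≡⟨ cong (_*_ (γ₁ + γ₂)) (split-productWeight γ₁ γ₂ a₁ a₂ g ss) ⟩
  (γ₁ + γ₂) * ((γ₁ + γ₂) ^ g * Π (λ s → a₁ s + a₂ s) ss)
    ≡⟨ ℤP.*-assoc (γ₁ + γ₂) _ _ ⟨
  (γ₁ + γ₂) ^ suc g * Π (λ s → a₁ s + a₂ s) ss ∎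
  where
  W : Weight₂
  W = productWeight γ₁ γ₂ a₁ a₂
  freeˡ : ∀ g₁ s₁ g₂ s₂ → onLeft newFree W g₁ s₁ g₂ s₂ ≡ γ₁ * W g₁ s₁ g₂ s₂
  freeˡ g₁ s₁ g₂ s₂ = solve 4 (λ x e₁ e₂ p → x :* e₁ :* e₂ :* p := x :* (e₁ :* e₂ :* p)) refl
                        γ₁ (γ₁ ^ g₁) (γ₂ ^ g₂) (Π a₁ s₁ * Π a₂ s₂)
  freeʳ : ∀ g₁ s₁ g₂ s₂ → onRight newFree W g₁ s₁ g₂ s₂ ≡ γ₂ * W g₁ s₁ g₂ s₂
  freeʳ g₁ s₁ g₂ s₂ = solve 4 (λ x e₁ e₂ p → e₁ :* (x :* e₂) :* p := x :* (e₁ :* e₂ :* p)) refl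
                        γ₂ (γ₁ ^ g₁) (γ₂ ^ g₂) (Π a₁ s₁ * Π a₂ s₂)
split-productWeight γ₁ γ₂ a₁ a₂ zero [] = refl
split-productWeight γ₁ γ₂ a₁ a₂ zero (s ∷ ss) = begin
  split (onLeft (addBlock s) W) zero ss + split (onRight (addBlock s) W) zero ss
    ≡⟨ cong₂ _+_ (trans (split-cong blockˡ zero ss) (split-*ˡ (a₁ s) W zero ss))
                 (trans (split-cong blockʳ zero ss) (split-*ˡ (a₂ s) W zero ss)) ⟩
  a₁ s * split W zero ss + a₂ s * split W zero ss
    ≡⟨ ℤP.*-distribʳ-+ (split W zero ss) (a₁ s) (a₂ s) ⟨
  (a₁ s + a₂ s) * split W zero ss
    ≡⟨ cong (_*_ (a₁ s + a₂ s)) (split-productWeight γ₁ γ₂ a₁ a₂ zero ss) ⟩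
  (a₁ s + a₂ s) * (+ 1 * Π (λ s → a₁ s + a₂ s) ss)
    ≡⟨ *-Semigroup.x∙yz≈y∙xz (a₁ s + a₂ s) (+ 1) _ ⟩
  + 1 * Π (λ s → a₁ s + a₂ s) (s ∷ ss) ∎
  where
  W : Weight₂
  W = productWeight γ₁ γ₂ a₁ a₂
  blockˡ : ∀ g₁ s₁ g₂ s₂ → onLeft (addBlock s) W g₁ s₁ g₂ s₂ ≡ a₁ s * W g₁ s₁ g₂ s₂
  blockˡ g₁ s₁ g₂ s₂ = solve 4 (λ x e p₁ p₂ → e :* (x :* p₁ :* p₂) := x :* (e :* (p₁ :* p₂))) refl
                         (a₁ s) (γ₁ ^ g₁ * γ₂ ^ g₂) (Π a₁ s₁) (Π a₂ s₂)
  blockʳ : ∀ g₁ s₁ g₂ s₂ → onRight (addBlock s) W g₁ s₁ g₂ s₂ ≡ a₂ s * W g₁ s₁ g₂ s₂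
  blockʳ g₁ s₁ g₂ s₂ = solve 4 (λ x e p₁ p₂ → e :* (p₁ :* (x :* p₂)) := x :* (e :* (p₁ :* p₂))) refl
                         (a₂ s) (γ₁ ^ g₁ * γ₂ ^ g₂) (Π a₁ s₁) (Π a₂ s₂)

𝟙 : Bool → ℤ
𝟙 b = indicator b (+ 1)

indicator≡𝟙* : ∀ b x → indicator b x ≡ 𝟙 b * x
indicator≡𝟙* true  x = sym (ℤP.*-identityˡ x)
indicator≡𝟙* false x = refl

indicator-∧ : ∀ b c x → indicator (b ∧ c) x ≡ 𝟙 b * indicator c x
indicator-∧ true  c x = sym (ℤP.*-identityˡ _)
indicator-∧ false c x = refl

indicator-*ˡ : ∀ b c x → indicator b (c * x) ≡ c * indicator b x
indicator-*ˡ true  c x = refl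
indicator-*ˡ false c x = sym (ℤP.*-zeroʳ c)

𝟙-isEmpty : ∀ (G : List ℕ) → 𝟙 (isEmpty G) ≡ (+ 0) ^ length G
𝟙-isEmpty []      = refl
𝟙-isEmpty (x ∷ G) = refl

module _ {A : Set} (p : A → Bool) where

  𝟙-allB : ∀ xs → 𝟙 (allB p xs) ≡ prodℤ (map (𝟙 ∘ p) xs)
  𝟙-allB []       = refl
  𝟙-allB (x ∷ xs) = trans (indicator-∧ (p x) (allB p xs) (+ 1)) (cong (_*_ (𝟙 (p x))) (𝟙-allB xs))

  indicator-allB : ∀ (f : A → ℤ) xs →
                   indicator (allB p xs) (prodℤ (map f xs)) ≡ prodℤ (map (λ x → indicator (p x) (f x)) xs)
  indicator-allB f []       = refl
  indicator-allB f (x ∷ xs) with p x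
  ... | true  = trans (indicator-*ˡ (allB p xs) (f x) _) (cong (_*_ (f x)) (indicator-allB f xs))
  ... | false = sym (ℤP.*-zeroˡ (prodℤ (map (λ x → indicator (p x) (f x)) xs)))

𝟙-convolution : ∀ k l₁ l₂ → ∑< (suc k) (λ j → 𝟙 (l₁ ≡ᵇ j) * 𝟙 (l₂ ≡ᵇ k ∸ j)) ≡ 𝟙 (l₁ ℕ.+ l₂ ≡ᵇ k)
𝟙-convolution k zero l₂ = begin
  + 1 * 𝟙 (l₂ ≡ᵇ k) + ∑< k (λ j → + 0 * 𝟙 (l₂ ≡ᵇ k ∸ suc j))
    ≡⟨ cong₂ _+_ (ℤP.*-identityˡ (𝟙 (l₂ ≡ᵇ k))) (∑<-zero k) ⟩
  𝟙 (l₂ ≡ᵇ k) + + 0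
    ≡⟨ ℤP.+-identityʳ _ ⟩
  𝟙 (l₂ ≡ᵇ k) ∎
𝟙-convolution zero    (suc l₁) l₂ = refl
𝟙-convolution (suc k) (suc l₁) l₂ = trans (ℤP.+-identityˡ _) (𝟙-convolution k l₁ l₂)

Π-sizes : ∀ (a : ℕ → ℤ) P → prodℤ (map (a ∘ length) P) ≡ Π a (sizes P)
Π-sizes a P = cong prodℤ (map-∘ P)

-- The large colour weighs γ per free element and 1 per block of size > ℓ; the small colour
-- weighs 0 per free element (so (+ 0) ^ g is the indicator of G = ∅, as 0^0 = 1) and
-- (β - α)_{s-1,α} per block of size s ≤ ℓ.
module RestrictedPartitions (k ℓ : ℕ) (α β γ : ℤ) where

  a₁ a₂ : ℕ → ℤ
  a₁ s = 𝟙 (ℓ <ᵇ s)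
  a₂ s = indicator (not (ℓ <ᵇ s)) (fallDeg (β - α) (s ∸ 1) α)

  bigWeight smallWeight : ℕ → Weight
  bigWeight   j g ss = 𝟙 (length ss ≡ᵇ j) * (γ ^ g * Π a₁ ss)
  smallWeight j g ss = 𝟙 (length ss ≡ᵇ j) * ((+ 0) ^ g * Π a₂ ss)

  restrictedWeight : Weight₂
  restrictedWeight g₁ s₁ g₂ s₂ = 𝟙 (length s₁ ℕ.+ length s₂ ≡ᵇ k) * productWeight γ (+ 0) a₁ a₂ g₁ s₁ g₂ s₂

  bigStirling≡∑configs : ∀ i j → bigStirling i j ℓ γ ≡ ∑configs i (bigWeight j)
  bigStirling≡∑configs i j = ∑-cong (λ (G , P) → begin
    indicator ((length P ≡ᵇ j) ∧ allB (λ B → ℓ <ᵇ length B) P) (γ ^ length G)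
      ≡⟨ trans (indicator-∧ (length P ≡ᵇ j) _ _)
               (cong (_*_ (𝟙 (length P ≡ᵇ j))) (indicator≡𝟙* (allB (λ B → ℓ <ᵇ length B) P) (γ ^ length G))) ⟩
    𝟙 (length P ≡ᵇ j) * (𝟙 (allB (λ B → ℓ <ᵇ length B) P) * γ ^ length G)
      ≡⟨ cong₂ (λ l x → 𝟙 (l ≡ᵇ j) * (x * γ ^ length G)) (sym (length-map length P))
               (trans (𝟙-allB (λ B → ℓ <ᵇ length B) P) (Π-sizes a₁ P)) ⟩
    𝟙 (length (sizes P) ≡ᵇ j) * (Π a₁ (sizes P) * γ ^ length G)
      ≡⟨ cong (_*_ (𝟙 (length (sizes P) ≡ᵇ j))) (ℤP.*-comm (Π a₁ (sizes P)) (γ ^ length G)) ⟩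
    bigWeight j (length G) (sizes P) ∎) (configs i)

  smallStirling≡∑configs : ∀ m j → smallStirling m j ℓ α β ≡ ∑configs m (smallWeight j)
  smallStirling≡∑configs m j = ∑-cong (λ (G , P) → begin
    indicator (isEmpty G ∧ (length P ≡ᵇ j) ∧ allB (λ B → not (ℓ <ᵇ length B)) P) (prodℤ (map (blockW α β) P))
      ≡⟨ trans (indicator-∧ (isEmpty G) _ _) (cong (_*_ (𝟙 (isEmpty G))) (indicator-∧ (length P ≡ᵇ j) _ _)) ⟩
    𝟙 (isEmpty G) * (𝟙 (length P ≡ᵇ j) * indicator (allB (λ B → not (ℓ <ᵇ length B)) P) (prodℤ (map (blockW α β) P)))
      ≡⟨ cong₂ (λ e x → e * (𝟙 (length P ≡ᵇ j) * x)) (𝟙-isEmpty G)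
               (trans (indicator-allB (λ B → not (ℓ <ᵇ length B)) (blockW α β) P) (Π-sizes a₂ P)) ⟩
    (+ 0) ^ length G * (𝟙 (length P ≡ᵇ j) * Π a₂ (sizes P))
      ≡⟨ *-Semigroup.x∙yz≈y∙xz ((+ 0) ^ length G) (𝟙 (length P ≡ᵇ j)) (Π a₂ (sizes P)) ⟩
    𝟙 (length P ≡ᵇ j) * ((+ 0) ^ length G * Π a₂ (sizes P))
      ≡⟨ cong (λ l → 𝟙 (l ≡ᵇ j) * ((+ 0) ^ length G * Π a₂ (sizes P))) (sym (length-map length P)) ⟩
    smallWeight j (length G) (sizes P) ∎) (configs m)

  blockWeight≡a₁+a₂ : ∀ s → (if ℓ <ᵇ s then + 1 else fallDeg (β - α) (s ∸ 1) α) ≡ a₁ s + a₂ s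
  blockWeight≡a₁+a₂ s with ℓ <ᵇ s
  ... | true  = refl
  ... | false = sym (ℤP.+-identityˡ _)

  restrictedS≡∑configs : ∀ n → restrictedS n k ℓ γ α β ≡ ∑configs n (split restrictedWeight)
  restrictedS≡∑configs n = ∑-cong (λ (G , P) → begin
    indicator (length P ≡ᵇ k) (γ ^ length G * prodℤ (map (λ B → if ℓ <ᵇ length B then + 1 else blockW α β B) P))
      ≡⟨ indicator≡𝟙* (length P ≡ᵇ k) _ ⟩
    𝟙 (length P ≡ᵇ k) * (γ ^ length G * prodℤ (map (λ B → if ℓ <ᵇ length B then + 1 else blockW α β B) P))
      ≡⟨ cong₂ (λ l x → 𝟙 (l ≡ᵇ k) * (γ ^ length G * x)) (sym (length-map length P))
               (trans (cong prodℤ (map-cong (blockWeight≡a₁+a₂ ∘ length) P)) (Π-sizes (λ s → a₁ s + a₂ s) P)) ⟩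
    𝟙 (length (sizes P) ≡ᵇ k) * (γ ^ length G * Π (λ s → a₁ s + a₂ s) (sizes P))
      ≡⟨ cong (λ c → 𝟙 (length (sizes P) ≡ᵇ k) * (c ^ length G * Π (λ s → a₁ s + a₂ s) (sizes P))) (sym (ℤP.+-identityʳ γ)) ⟩
    𝟙 (length (sizes P) ≡ᵇ k) * ((γ + + 0) ^ length G * Π (λ s → a₁ s + a₂ s) (sizes P))
      ≡⟨ cong (_*_ (𝟙 (length (sizes P) ≡ᵇ k))) (split-productWeight γ (+ 0) a₁ a₂ (length G) (sizes P)) ⟨
    𝟙 (length (sizes P) ≡ᵇ k) * split (productWeight γ (+ 0) a₁ a₂) (length G) (sizes P)
      ≡⟨ split-blockCount (λ l → 𝟙 (l ≡ᵇ k)) (productWeight γ (+ 0) a₁ a₂) (length G) (sizes P) ⟨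
    split restrictedWeight (length G) (sizes P) ∎) (configs n)

  convolution : ∀ g₁ s₁ g₂ s₂ →
    sumTo k (λ j → bigWeight j g₁ s₁ * smallWeight (k ∸ j) g₂ s₂) ≡ restrictedWeight g₁ s₁ g₂ s₂
  convolution g₁ s₁ g₂ s₂ = begin
    sumTo k (λ j → bigWeight j g₁ s₁ * smallWeight (k ∸ j) g₂ s₂)
      ≡⟨ ∑-cong (λ j → solve 6 (λ i₁ e₁ p₁ i₂ e₂ p₂ → i₁ :* (e₁ :* p₁) :* (i₂ :* (e₂ :* p₂))
                                                    := i₁ :* i₂ :* (e₁ :* e₂ :* (p₁ :* p₂))) refl
                  (𝟙 (length s₁ ≡ᵇ j)) (γ ^ g₁) (Π a₁ s₁) (𝟙 (length s₂ ≡ᵇ k ∸ j)) ((+ 0) ^ g₂) (Π a₂ s₂))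
                (upTo (suc k)) ⟩
    sumTo k (λ j → indicators j * W)
      ≡⟨ ∑-*ʳ W indicators (upTo (suc k)) ⟨
    sumTo k indicators * W
      ≡⟨ cong (_* W) (trans (sumTo≡∑< k indicators) (𝟙-convolution k (length s₁) (length s₂))) ⟩
    restrictedWeight g₁ s₁ g₂ s₂ ∎
    where
    W : ℤ
    W = productWeight γ (+ 0) a₁ a₂ g₁ s₁ g₂ s₂
    indicators : ℕ → ℤ
    indicators j = 𝟙 (length s₁ ≡ᵇ j) * 𝟙 (length s₂ ≡ᵇ k ∸ j)

  ∑configs²≡sumTo : ∀ i m →
    ∑configs² i m restrictedWeight ≡ sumTo k (λ j → bigStirling i j ℓ γ * smallStirling m (k ∸ j) ℓ α β)
  ∑configs²≡sumTo i m = begin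
    ∑configs² i m restrictedWeight
      ≡⟨ ∑-cong (λ (G₁ , P₁) → ∑-cong (λ (G₂ , P₂) → convolution (length G₁) (sizes P₁) (length G₂) (sizes P₂))
                                      (configs m)) (configs i) ⟨
    ∑ (λ c₁ → ∑ (λ c₂ → ∑ (λ j → X j c₁ c₂) (upTo (suc k))) (configs m)) (configs i)
      ≡⟨ ∑-cong (λ c₁ → ∑-comm (λ j c₂ → X j c₁ c₂) (upTo (suc k)) (configs m)) (configs i) ⟩
    ∑ (λ c₁ → ∑ (λ j → ∑ (X j c₁) (configs m)) (upTo (suc k))) (configs i)
      ≡⟨ ∑-comm (λ j c₁ → ∑ (X j c₁) (configs m)) (upTo (suc k)) (configs i) ⟩
    sumTo k (λ j → ∑ (λ c₁ → ∑ (X j c₁) (configs m)) (configs i))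
      ≡⟨ ∑-cong (λ j → ∑-*-∑ (profile (bigWeight j)) (profile (smallWeight (k ∸ j))) (configs i) (configs m)) (upTo (suc k)) ⟨
    sumTo k (λ j → ∑configs i (bigWeight j) * ∑configs m (smallWeight (k ∸ j)))
      ≡⟨ ∑-cong (λ j → cong₂ _*_ (bigStirling≡∑configs i j) (smallStirling≡∑configs m (k ∸ j))) (upTo (suc k)) ⟨
    sumTo k (λ j → bigStirling i j ℓ γ * smallStirling m (k ∸ j) ℓ α β) ∎
    where
    X : ℕ → Config → Config → ℤ
    X j c₁ c₂ = profile (bigWeight j) c₁ * profile (smallWeight (k ∸ j)) c₂

mainTheorem5 : (n k ℓ α β γ : ℕ) →
    restrictedS n k ℓ (+ γ) (+ α) (+ β)
      ≡ sumTo n (λ i → sumTo k (λ j →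
          (+ (n C i)) * bigStirling i j ℓ (+ γ) * smallStirling (n ∸ i) (k ∸ j) ℓ (+ α) (+ β)))
mainTheorem5 n k ℓ α β γ = begin
  restrictedS n k ℓ (+ γ) (+ α) (+ β)                    ≡⟨ restrictedS≡∑configs n ⟩
  ∑configs n (split restrictedWeight)                    ≡⟨ ∑configs-split n restrictedWeight ⟩
  latticeSum n (λ i j → ∑configs² i j restrictedWeight)  ≡⟨ latticeSum≡binomialSum n _ ⟩
  ∑< (suc n) (λ i → + (n C i) * ∑configs² i (n ∸ i) restrictedWeight)
                                                         ≡⟨ ∑<-cong (suc n) (λ i _ → term≡ i) ⟩
  ∑< (suc n) term                                        ≡⟨ sumTo≡∑< n term ⟨
  sumTo n term                                           ∎
  where
  open RestrictedPartitions k ℓ (+ α) (+ β) (+ γ)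
  term : ℕ → ℤ
  term i = sumTo k (λ j → (+ (n C i)) * bigStirling i j ℓ (+ γ) * smallStirling (n ∸ i) (k ∸ j) ℓ (+ α) (+ β))
  term≡ : ∀ i → + (n C i) * ∑configs² i (n ∸ i) restrictedWeight ≡ term i
  term≡ i = begin
    + (n C i) * ∑configs² i (n ∸ i) restrictedWeight
      ≡⟨ cong (_*_ (+ (n C i))) (∑configs²≡sumTo i (n ∸ i)) ⟩
    + (n C i) * sumTo k (λ j → bigStirling i j ℓ (+ γ) * smallStirling (n ∸ i) (k ∸ j) ℓ (+ α) (+ β))
      ≡⟨ ∑-*ˡ (+ (n C i)) _ (upTo (suc k)) ⟩
    sumTo k (λ j → + (n C i) * (bigStirling i j ℓ (+ γ) * smallStirling (n ∸ i) (k ∸ j) ℓ (+ α) (+ β)))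
      ≡⟨ ∑-cong (λ j → sym (ℤP.*-assoc (+ (n C i)) _ _)) (upTo (suc k)) ⟩
    term i ∎
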